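{- Let $X$ be a finite non-empty set and let $R$ be a monotone transit function on $X$. Then the following three conditions are equivalent: (w) for all $x,y,z\in X$: $z\in R(x,y)$ or $y\in R(x,z)$ or $x\in R(y,z)$; (w$_2$) for all $p,q,u,v,s,t\in X$: $R(p,q)\cap R(u,v)\cap R(s,t)\in\{R(p,q)\cap R(u,v),\ R(p,q)\cap R(s,t),\ R(u,v)\cap R(s,t)\}$; (w$_3$) for all $u,v,p,q,x,y,z\in X$: if $x\in R(u,v)\setminus R(p,q)$, $y\in R(u,v)\cap R(p,q)$ and $z\in R(p,q)\setminus R(u,v)$, then $y\in R(x,z)$.
   Context: A transit function on a finite non-empty set $X$ is a map $R:X\times X\to 2^X$ such that for all $u,v\in X$: $u\in R(u,v)$, $R(u,v)=R(v,u)$, and $R(u,u)=\{u\}$. $R$ is monotone if for all $u,v,p,q\in X$, $p,q\in R(u,v)$ implies $R(p,q)\subseteq R(u,v)$. -}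

module Defs where

open import Data.Nat using (ℕ)
open import Data.Fin using (Fin)
open import Data.Fin.Subset using (Subset; _∈_; _∉_; _⊆_; _∩_; ⁅_⁆)
open import Data.Product using (_×_)
open import Data.Sum using (_⊎_)
open import Relation.Binary.PropositionalEquality using (_≡_)

record IsTransit {n : ℕ} (R : Fin n → Fin n → Subset n) : Set where
  field
    ext  : ∀ u v → u ∈ R u v
    symm : ∀ u v → R u v ≡ R v u
    idem : ∀ u → R u u ≡ ⁅ u ⁆

Monotone : {n : ℕ} → (Fin n → Fin n → Subset n) → Set
Monotone R = ∀ u v p q → p ∈ R u v → q ∈ R u v → R p q ⊆ R u v

AxW : {n : ℕ} → (Fin n → Fin n → Subset n) → Set
AxW R = ∀ x y z → (z ∈ R x y) ⊎ ((y ∈ R x z) ⊎ (x ∈ R y z))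

AxW₂ : {n : ℕ} → (Fin n → Fin n → Subset n) → Set
AxW₂ R = ∀ p q u v s t →
  let A = R p q ; B = R u v ; C = R s t in
  ((A ∩ B) ∩ C ≡ A ∩ B) ⊎ (((A ∩ B) ∩ C ≡ A ∩ C) ⊎ ((A ∩ B) ∩ C ≡ B ∩ C))

AxW₃ : {n : ℕ} → (Fin n → Fin n → Subset n) → Set
AxW₃ R = ∀ u v p q x y z →
  (x ∈ R u v × x ∉ R p q) →
  (y ∈ R u v × y ∈ R p q) →
  (z ∈ R p q × z ∉ R u v) →
  y ∈ R x z

{-# OPTIONS --safe #-}

-- Read (w₂) as: for any three intervals A, B, C, one of A ∩ B ⊆ C, A ∩ C ⊆ B,
-- B ∩ C ⊆ A holds. Given x ∈ A ∩ B, y ∈ A ∩ C and z ∈ B ∩ C, axiom (w) for x, y, z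
-- together with monotonicity puts z in A, y in B or x in C, so the three
-- inclusions cannot all fail. Conversely, applying (w₂) to R(u,v), R(p,q), R(x,z)
-- gives (w₃), since x and z rule out the last two inclusions; and (w) is (w₃)
-- for the intervals R(x,y) and R(y,z).

module Submission where

open import Defs
open import Data.Nat using (ℕ; suc)
open import Data.Fin using (Fin)
open import Data.Fin.Properties using (¬∀⟶∃¬)
open import Data.Fin.Subset using (Subset; _∈_; _∉_; _⊆_; _⊈_; _∩_)
open import Data.Fin.Subset.Properties
  using (_∈?_; _⊆?_; ⊆-antisym; p∩q⊆p; x∈p∩q⁺; x∈p∩q⁻; ∩-commutativeMonoid)
open import Data.Product using (_×_; _,_; ∃)
open import Data.Sum as Sum using (_⊎_; inj₁; inj₂; [_,_]′)
open import Data.Sum.Function.Propositional using (_⊎-⇔_)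
open import Data.Empty using (⊥-elim)
open import Relation.Nullary using (yes; no; _→-dec_; contradiction)
open import Relation.Binary.PropositionalEquality using (_≡_; subst; sym)
open import Algebra.Bundles using (CommutativeMonoid)
open import Function.Bundles using (_⇔_; mk⇔; Equivalence)
open import Function.Properties.Equivalence using () renaming (trans to ⇔-trans)
open import Function using (_∘_)

module _ {m : ℕ} where

  open import Algebra.Properties.CommutativeSemigroup
    (CommutativeMonoid.commutativeSemigroup (∩-commutativeMonoid m))
    using (xy∙z≈xz∙y; xy∙z≈yz∙x)

  ⊈⇒∃∈∉ : {p q : Subset m} → p ⊈ q → ∃ λ x → x ∈ p × x ∉ q
  ⊈⇒∃∈∉ {p} {q} p⊈q with ¬∀⟶∃¬ m _ (λ x → (x ∈? p) →-dec (x ∈? q)) (λ p⊆q → p⊈q (p⊆q _))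
  ... | x , x∈p⇏x∈q with x ∈? p
  ...   | yes x∈p = x , x∈p , λ x∈q → x∈p⇏x∈q (λ _ → x∈q)
  ...   | no x∉p  = contradiction (λ x∈p → contradiction x∈p x∉p) x∈p⇏x∈q

  p∩q≡p⇔p⊆q : {p q : Subset m} → p ∩ q ≡ p ⇔ p ⊆ q
  p∩q≡p⇔p⊆q {p} {q} = mk⇔ to from
    where
    to : p ∩ q ≡ p → p ⊆ q
    to p∩q≡p x∈p with x∈p∩q⁻ p q (subst (_ ∈_) (sym p∩q≡p) x∈p)
    ... | _ , x∈q = x∈q

    from : p ⊆ q → p ∩ q ≡ p
    from p⊆q = ⊆-antisym (p∩q⊆p p q) (λ x∈p → x∈p∩q⁺ (x∈p , p⊆q x∈p))

  ≡-congˡ-⇔ : {r s t : Subset m} → r ≡ s → (r ≡ t) ⇔ (s ≡ t)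
  ≡-congˡ-⇔ r≡s = mk⇔ (subst (_≡ _) r≡s) (subst (_≡ _) (sym r≡s))

  SomeMeetBelowThird : Subset m → Subset m → Subset m → Set
  SomeMeetBelowThird A B C = A ∩ B ⊆ C ⊎ (A ∩ C ⊆ B ⊎ B ∩ C ⊆ A)

  ∩∩≡-cases⇔SomeMeetBelowThird : (A B C : Subset m) →
    ((A ∩ B) ∩ C ≡ A ∩ B ⊎ ((A ∩ B) ∩ C ≡ A ∩ C ⊎ (A ∩ B) ∩ C ≡ B ∩ C))
      ⇔ SomeMeetBelowThird A B C
  ∩∩≡-cases⇔SomeMeetBelowThird A B C =
    p∩q≡p⇔p⊆q
      ⊎-⇔ (⇔-trans (≡-congˡ-⇔ (xy∙z≈xz∙y A B C)) p∩q≡p⇔p⊆q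
      ⊎-⇔ ⇔-trans (≡-congˡ-⇔ (xy∙z≈yz∙x A B C)) p∩q≡p⇔p⊆q)

  someMeetBelowThird : (A B C : Subset m) →
    (∀ {x y z} → x ∈ A ∩ B → y ∈ A ∩ C → z ∈ B ∩ C → z ∈ A ⊎ (y ∈ B ⊎ x ∈ C)) →
    SomeMeetBelowThird A B C
  someMeetBelowThird A B C witness with A ∩ B ⊆? C | A ∩ C ⊆? B | B ∩ C ⊆? A
  ... | yes AB⊆C | _        | _        = inj₁ AB⊆C
  ... | no _     | yes AC⊆B | _        = inj₂ (inj₁ AC⊆B)
  ... | no _     | no _     | yes BC⊆A = inj₂ (inj₂ BC⊆A)
  ... | no AB⊈C  | no AC⊈B  | no BC⊈A
    with ⊈⇒∃∈∉ AB⊈C | ⊈⇒∃∈∉ AC⊈B | ⊈⇒∃∈∉ BC⊈A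
  ... | x , x∈AB , x∉C | y , y∈AC , y∉B | z , z∈BC , z∉A =
    ⊥-elim ([ z∉A , [ y∉B , x∉C ]′ ]′ (witness x∈AB y∈AC z∈BC))

module _ {n : ℕ} {R : Fin n → Fin n → Subset n} where

  w⇒w₂ : Monotone R → AxW R → AxW₂ R
  w⇒w₂ mono w p q u v s t =
    Equivalence.from (∩∩≡-cases⇔SomeMeetBelowThird A B C)
      (someMeetBelowThird A B C pushIntoThird)
    where
    A = R p q ; B = R u v ; C = R s t

    pushIntoThird : ∀ {x y z} → x ∈ A ∩ B → y ∈ A ∩ C → z ∈ B ∩ C →
      z ∈ A ⊎ (y ∈ B ⊎ x ∈ C)
    pushIntoThird {x} {y} {z} x∈AB y∈AC z∈BC
      with x∈p∩q⁻ A B x∈AB | x∈p∩q⁻ A C y∈AC | x∈p∩q⁻ B C z∈BC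
    ... | x∈A , x∈B | y∈A , y∈C | z∈B , z∈C =
      Sum.map (mono p q x y x∈A y∈A)
              (Sum.map (mono u v x z x∈B z∈B) (mono s t y z y∈C z∈C))
              (w x y z)

  module _ (transit : IsTransit R) where
    open IsTransit transit

    extʳ : ∀ u v → v ∈ R u v
    extʳ u v = subst (v ∈_) (symm v u) (ext v u)

    w₂⇒w₃ : AxW₂ R → AxW₃ R
    w₂⇒w₃ w₂ u v p q x y z (x∈uv , x∉pq) (y∈uv , y∈pq) (z∈pq , z∉uv)
      with Equivalence.to (∩∩≡-cases⇔SomeMeetBelowThird (R u v) (R p q) (R x z)) (w₂ u v p q x z)
    ... | inj₁ uv∩pq⊆xz        = uv∩pq⊆xz (x∈p∩q⁺ (y∈uv , y∈pq))
    ... | inj₂ (inj₁ uv∩xz⊆pq) = contradiction (uv∩xz⊆pq (x∈p∩q⁺ (x∈uv , ext x z))) x∉pq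
    ... | inj₂ (inj₂ pq∩xz⊆uv) = contradiction (pq∩xz⊆uv (x∈p∩q⁺ (z∈pq , extʳ x z))) z∉uv

    w₃⇒w : AxW₃ R → AxW R
    w₃⇒w w₃ x y z with z ∈? R x y | x ∈? R y z
    ... | yes z∈xy | _        = inj₁ z∈xy
    ... | no _     | yes x∈yz = inj₂ (inj₂ x∈yz)
    ... | no z∉xy  | no x∉yz  =
      inj₂ (inj₁ (w₃ x y y z x y z (ext x y , x∉yz) (extʳ x y , ext y z) (extʳ y z , z∉xy)))

theorem1 : (n : ℕ) (R : Fin (suc n) → Fin (suc n) → Subset (suc n)) →
    IsTransit R → Monotone R →
    ((AxW R ⇔ AxW₂ R) × (AxW₂ R ⇔ AxW₃ R))
theorem1 n R transit mono =
  mk⇔ (w⇒w₂ mono) (w₃⇒w transit ∘ w₂⇒w₃ transit) ,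
  mk⇔ (w₂⇒w₃ transit) (w⇒w₂ mono ∘ w₃⇒w transit)
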